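{- Let $v$ and $k$ be positive integers such that every prime factor of $v$ is congruent to $1$ modulo $k$. Then there exists a Ferrero $(v,k,k-1)$-DDF in every abelian group $G$ of order $v$.
   Context: For a subset $B$ of an additive group $G$, $\Delta B$ is the multiset of all differences $b-b'$ of distinct $b,b'\in B$. A $(v,k,\lambda)$-DDF (disjoint difference family) in a group $G$ of order $v$ is a collection of pairwise disjoint $k$-subsets of $G$ whose lists of differences together cover every non-zero element of $G$ exactly $\lambda$ times. A Ferrero pair is a pair $(G,A)$ with $A$ a non-trivial group of automorphisms of $G$ such that $\alpha(g)=g$ for $\alpha\in A$, $g\in G$ only if $\alpha=\mathrm{id}$ or $g=0$. A Ferrero $(v,k,k-1)$-DDF in $G$ is the set of $A$-orbits on $G\setminus\{0\}$ for a Ferrero pair $(G,A)$ with $|G|=v$, $|A|=k$. -}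

module Defs where

open import Level using (0ℓ)
open import Data.Nat using (ℕ; _∸_)
open import Data.Nat.Divisibility using (_∣_)
open import Data.Nat.Primality using (Prime)
open import Data.Fin using (Fin)
open import Data.Product using (Σ; ∃; _×_)
open import Data.Sum using (_⊎_)
open import Relation.Binary.PropositionalEquality using (_≡_; _≢_)
open import Relation.Nullary using (¬_)
open import Algebra.Core using (Op₁; Op₂)
open import Algebra.Structures using (IsAbelianGroup)
open import Function.Definitions using (Bijective)

-- An abelian group of order v, presented (up to isomorphism) on the
-- carrier Fin v with propositional equality.
record FinAbelianGroup (v : ℕ) : Set where
  field
    _∙_ : Op₂ (Fin v)
    ε : Fin v
    _⁻¹ : Op₁ (Fin v)
    isAbelianGroup : IsAbelianGroup _≡_ _∙_ ε _⁻¹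

AllPrimeFactors≡1Mod : ℕ → ℕ → Set
AllPrimeFactors≡1Mod v k = ∀ p → Prime p → p ∣ v → k ∣ (p ∸ 1)

module _ {v : ℕ} (G : FinAbelianGroup v) where
  open FinAbelianGroup G

  IsAutomorphism : (Fin v → Fin v) → Set
  IsAutomorphism α = (∀ x y → α (x ∙ y) ≡ α x ∙ α y) × Bijective _≡_ _≡_ α

  _≐_ : (Fin v → Fin v) → (Fin v → Fin v) → Set
  f ≐ g = ∀ x → f x ≡ g x

  idMap : Fin v → Fin v
  idMap x = x

  -- A group of automorphisms of G of order k, given as an injective
  -- enumeration A : Fin k → Aut(G) of its elements (up to extensional
  -- equality), containing the identity and closed under composition and
  -- inverses.
  record IsAutGroupOfOrder (k : ℕ) (A : Fin k → Fin v → Fin v) : Set where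
    field
      auto     : ∀ i → IsAutomorphism (A i)
      distinct : ∀ i j → A i ≐ A j → i ≡ j
      hasId    : ∃ λ i → A i ≐ idMap
      closed∘  : ∀ i j → ∃ λ l → A l ≐ (λ x → A i (A j x))
      closed⁻¹ : ∀ i → ∃ λ j → (∀ x → A j (A i x) ≡ x) × (∀ x → A i (A j x) ≡ x)

  record IsFerreroPair (k : ℕ) (A : Fin k → Fin v → Fin v) : Set where
    field
      autGroup   : IsAutGroupOfOrder k A
      nontrivial : ∃ λ i → ¬ (A i ≐ idMap)
      fpf        : ∀ i g → A i g ≡ g → (A i ≐ idMap) ⊎ (g ≡ ε)

  -- There is a Ferrero (v,k,k-1)-DDF in G, i.e. the set of A-orbits on
  -- G ∖ {0} for some Ferrero pair (G, A) with |A| = k.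
  HasFerreroDDF : ℕ → Set
  HasFerreroDDF k = Σ (Fin k → Fin v → Fin v) (IsFerreroPair k)

module Submission where

-- Idea: find an integer m such that m^k ≡ 1 (mod v) while, for every prime
-- q ∣ v and 0 < i < k, m^i ≢ 1 (mod q).  Then x ↦ M^i · x (i < k, M ≡ m)
-- are automorphisms of G (G is abelian) forming a cyclic group of order k,
-- and M^i · x = x forces x = ε, because M^i - 1 is prime to v = |G| and
-- v · x = ε (Lagrange).

open import Defs
open import Data.Nat using (ℕ; _≤_)

open import Level using (0ℓ)
open import Algebra.Bundles using (CommutativeMonoid; AbelianGroup)
open import Data.Nat as ℕ using (zero; suc; _<_; s≤s; z≤n; NonZero)
import Data.Nat.Properties as ℕP
import Data.Nat.Divisibility as ℕD
import Data.Nat.DivMod as ℕDM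
import Data.Nat.Tactic.RingSolver as ℕSolver
open import Data.Nat.Coprimality using (Coprime; coprime⇒gcd≡1; coprime-Bézout; coprime-divisor) renaming (sym to coprime-sym)
open import Data.Nat.GCD using (module GCD; module Bézout)
open import Data.Nat.LCM using (lcm; lcm-least; gcd*lcm)
open import Data.Nat.Induction using (<-rec)
open import Data.Nat.ListAction using (product)
open import Data.Nat.Primality using (Prime; euclidsLemma; prime⇒irreducible; prime⇒nonZero; prime⇒nonTrivial; ¬prime[1])
open import Data.Nat.Primality.Factorisation using (factorise; PrimeFactorisation; factors)
open import Data.Integer as ℤ using (ℤ; +_; _+_; _*_; _-_; -_; _^_; ∣_∣; 0ℤ; 1ℤ)
import Data.Integer.Properties as ℤP
import Data.Integer.DivMod as ℤDM
open import Data.Integer.Divisibility.Signed using (_∣_; _∣?_; divides; ∣m∣n⇒∣m+n; ∣m∣n⇒∣m-n; ∣m⇒∣-m; ∣m⇒∣m*n; ∣n⇒∣m*n; ∣ᵤ⇒∣; ∣⇒∣ᵤ; ∣-trans)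
open import Data.Integer.Tactic.RingSolver using (solve-∀)
open import Data.Fin as Fin using (Fin; toℕ; fromℕ<; punchIn)
import Data.Fin.Properties as FinP
open import Data.Fin.Permutation using (Permutation; permutation; remove; punchIn-permute; _⟨$⟩ʳ_)
open import Data.Vec.Functional using (replicate)
open import Data.List using (List; []; _∷_; length)
open import Data.List.Relation.Unary.All using (All; []; _∷_)
open import Data.List.Relation.Unary.AllPairs using (AllPairs; []; _∷_)
open import Data.Product using (∃; _×_; _,_; proj₁; proj₂)
open import Data.Sum using (_⊎_; inj₁; inj₂; [_,_]′)
open import Data.Empty using (⊥; ⊥-elim)
open import Relation.Nullary using (¬_; Dec; yes; no)
import Relation.Nullary.Decidable as Dec
open import Relation.Binary.Definitions using (tri<; tri≈; tri>)
import Relation.Binary.PropositionalEquality as ≡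
open import Relation.Binary.PropositionalEquality using (_≡_; _≢_; refl; sym; trans; cong; subst; subst₂; module ≡-Reasoning)

infix 4 _≡_mod_
record _≡_mod_ (a b : ℤ) (n : ℕ) : Set where
  constructor mod-intro
  field n∣a-b : + n ∣ (a - b)
open _≡_mod_ public

private
  diff-self : ∀ a → 0ℤ ≡ a - a
  diff-self = solve-∀
  diff-swap : ∀ a b → - (a - b) ≡ b - a
  diff-swap = solve-∀
  diff-chain : ∀ a b c → (a - b) + (b - c) ≡ a - c
  diff-chain = solve-∀
  diff-sum : ∀ a b c d → (a - b) + (c - d) ≡ (a + c) - (b + d)
  diff-sum = solve-∀
  diff-product : ∀ a b c d → (a - b) * c + b * (c - d) ≡ a * c - b * d
  diff-product = solve-∀
  drop-one : ∀ a → (1ℤ + a) - 1ℤ ≡ a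
  drop-one = solve-∀

module _ {n : ℕ} where

  mod-refl : ∀ {a} → a ≡ a mod n
  mod-refl {a} = mod-intro (subst (+ n ∣_) (diff-self a) (divides 0ℤ refl))

  mod-reflexive : ∀ {a b} → a ≡ b → a ≡ b mod n
  mod-reflexive refl = mod-refl

  mod-sym : ∀ {a b} → a ≡ b mod n → b ≡ a mod n
  mod-sym {a} {b} (mod-intro d) = mod-intro (subst (+ n ∣_) (diff-swap a b) (∣m⇒∣-m d))

  mod-trans : ∀ {a b c} → a ≡ b mod n → b ≡ c mod n → a ≡ c mod n
  mod-trans {a} {b} {c} (mod-intro d) (mod-intro e) =
    mod-intro (subst (+ n ∣_) (diff-chain a b c) (∣m∣n⇒∣m+n d e))

  mod-+ : ∀ {a b c d} → a ≡ b mod n → c ≡ d mod n → a + c ≡ b + d mod n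
  mod-+ {a} {b} {c} {d} (mod-intro e) (mod-intro f) =
    mod-intro (subst (+ n ∣_) (diff-sum a b c d) (∣m∣n⇒∣m+n e f))

  mod-* : ∀ {a b c d} → a ≡ b mod n → c ≡ d mod n → a * c ≡ b * d mod n
  mod-* {a} {b} {c} {d} (mod-intro e) (mod-intro f) =
    mod-intro (subst (+ n ∣_) (diff-product a b c d) (∣m∣n⇒∣m+n (∣m⇒∣m*n c e) (∣n⇒∣m*n b f)))

  mod-^ : ∀ {a b} e → a ≡ b mod n → a ^ e ≡ b ^ e mod n
  mod-^ zero    _ = mod-refl
  mod-^ (suc e) h = mod-* h (mod-^ e h)

mod-weaken : ∀ {m n a b} → m ℕD.∣ n → a ≡ b mod n → a ≡ b mod m
mod-weaken m∣n (mod-intro d) = mod-intro (∣-trans (∣ᵤ⇒∣ m∣n) d)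

-- Coprime divisors of c divide c jointly, because then lcm m n = m * n.
coprime-divisors : ∀ {m n c} → Coprime m n → m ℕD.∣ c → n ℕD.∣ c → m ℕ.* n ℕD.∣ c
coprime-divisors {m} {n} cop m∣c n∣c = subst (ℕD._∣ _) lcm≡mn (lcm-least m∣c n∣c)
  where
  lcm≡mn : lcm m n ≡ m ℕ.* n
  lcm≡mn = trans (sym (ℕP.*-identityˡ (lcm m n)))
             (trans (cong (ℕ._* lcm m n) (sym (coprime⇒gcd≡1 cop))) (gcd*lcm m n))

mod-glue : ∀ {m n a b} → Coprime m n → a ≡ b mod m → a ≡ b mod n → a ≡ b mod (m ℕ.* n)
mod-glue cop (mod-intro d) (mod-intro e) = mod-intro (∣ᵤ⇒∣ (coprime-divisors cop (∣⇒∣ᵤ d) (∣⇒∣ᵤ e)))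

ℤ*-mod : ℕ → CommutativeMonoid 0ℓ 0ℓ
ℤ*-mod n = record
  { Carrier = ℤ ; _≈_ = _≡_mod n ; _∙_ = _*_ ; ε = 1ℤ
  ; isCommutativeMonoid = record
    { isMonoid = record
      { isSemigroup = record
        { isMagma = record
          { isEquivalence = record { refl = mod-refl ; sym = mod-sym ; trans = mod-trans }
          ; ∙-cong = mod-* }
        ; assoc = λ x y z → mod-reflexive (ℤP.*-assoc x y z) }
      ; identity = (λ x → mod-reflexive (ℤP.*-identityˡ x)) , (λ x → mod-reflexive (ℤP.*-identityʳ x)) }
    ; comm = λ x y → mod-reflexive (ℤP.*-comm x y) } }

-- Specialised to translations
-- this yields both Lagrange's theorem for abelian groups and Fermat's
-- little theorem.
module _ {c ℓ} (M : CommutativeMonoid c ℓ) where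
  open CommutativeMonoid M
  open import Algebra.Properties.CommutativeMonoid.Sum M using (sum; sum-permute; sum-cong-≋; ∑-distrib-+; sum-replicate)
  open import Algebra.Properties.CommutativeMonoid.Mult M using () renaming (_×_ to _·_)
  open import Relation.Binary.Reasoning.Setoid setoid

  product-of-translates : ∀ {n} (f : Fin n → Carrier) (π : Permutation n n) a →
    (∀ i → f (π ⟨$⟩ʳ i) ≈ a ∙ f i) → sum f ≈ (n · a) ∙ sum f
  product-of-translates {n} f π a shift = begin
    sum f                       ≈⟨ sum-permute f π ⟩
    sum (λ i → f (π ⟨$⟩ʳ i))    ≈⟨ sum-cong-≋ shift ⟩
    sum (λ i → a ∙ f i)         ≈⟨ ∑-distrib-+ (replicate n a) f ⟩
    sum (replicate n a) ∙ sum f ≈⟨ ∙-congʳ (sum-replicate n) ⟩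
    (n · a) ∙ sum f             ∎

small-incongruent : ∀ {n a b} → b < a → a < n → ¬ (+ a ≡ + b mod n)
small-incongruent {n} {a} {b} b<a a<n (mod-intro n∣a-b) =
  ℕD.>⇒∤ {{ℕ.>-nonZero (ℕP.m<n⇒0<n∸m b<a)}} (ℕP.≤-<-trans (ℕP.m∸n≤m a b) a<n) n∣a∸b
  where
  ∣a-b∣≡a∸b : ∣ + a - + b ∣ ≡ a ℕ.∸ b
  ∣a-b∣≡a∸b = trans (cong ∣_∣ (ℤP.m-n≡m⊖n a b))
                (trans (ℤP.∣m⊖n∣≡∣n⊖m∣ a b) (ℤP.∣⊖∣-≤ (ℕP.<⇒≤ b<a)))
  n∣a∸b : n ℕD.∣ a ℕ.∸ b
  n∣a∸b = subst (n ℕD.∣_) ∣a-b∣≡a∸b (∣⇒∣ᵤ n∣a-b)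

small-mod-injective : ∀ {n a b} → a < n → b < n → + a ≡ + b mod n → a ≡ b
small-mod-injective {a = a} {b} a<n b<n a≡b with ℕP.<-cmp a b
... | tri< a<b _ _ = ⊥-elim (small-incongruent a<b b<n (mod-sym a≡b))
... | tri≈ _ a≡b _ = a≡b
... | tri> _ _ b<a = ⊥-elim (small-incongruent b<a a<n a≡b)

module Residue (n : ℕ) .{{_ : NonZero n}} where

  residue : ℤ → Fin n
  residue x = fromℕ< (ℤDM.n%ℕd<d x n)

  residue-≡ : ∀ x → + toℕ (residue x) ≡ x mod n
  residue-≡ x = subst (λ r → + r ≡ x mod n) (sym (FinP.toℕ-fromℕ< (ℤDM.n%ℕd<d x n)))
                  (mod-intro (divides (- q) r-x≡-q*n))
    where
    open ≡-Reasoning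
    r q : ℤ
    r = + (x ℤ.%ℕ n)
    q = x ℤ./ℕ n
    cancel : ∀ r q n → r - (r + q * n) ≡ - q * n
    cancel = solve-∀
    r-x≡-q*n : r - x ≡ - q * + n
    r-x≡-q*n = begin
      r - x              ≡⟨ cong (λ y → r - y) (ℤDM.a≡a%ℕn+[a/ℕn]*n x n) ⟩
      r - (r + q * + n)  ≡⟨ cancel r q (+ n) ⟩
      - q * + n          ∎

  residue-cong : ∀ {x y} → x ≡ y mod n → residue x ≡ residue y
  residue-cong {x} {y} x≡y = FinP.toℕ-injective
    (small-mod-injective (FinP.toℕ<n (residue x)) (FinP.toℕ<n (residue y))
      (mod-trans (residue-≡ x) (mod-trans x≡y (mod-sym (residue-≡ y)))))

  residue-toℕ : ∀ i → residue (+ toℕ i) ≡ i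
  residue-toℕ i = FinP.toℕ-injective
    (small-mod-injective (FinP.toℕ<n (residue (+ toℕ i))) (FinP.toℕ<n i) (residue-≡ (+ toℕ i)))

euclidℤ : ∀ {p} → Prime p → ∀ a b → + p ∣ a * b → (+ p ∣ a) ⊎ (+ p ∣ b)
euclidℤ {p} p-prime a b p∣ab with euclidsLemma ∣ a ∣ ∣ b ∣ p-prime (subst (p ℕD.∣_) (ℤP.abs-* a b) (∣⇒∣ᵤ p∣ab))
... | inj₁ p∣a = inj₁ (∣ᵤ⇒∣ p∣a)
... | inj₂ p∣b = inj₂ (∣ᵤ⇒∣ p∣b)

prime-coprime : ∀ {p a} → Prime p → ¬ (p ℕD.∣ a) → Coprime p a
prime-coprime p-prime p∤a (d∣p , d∣a) with prime⇒irreducible p-prime d∣p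
... | inj₁ d≡1 = d≡1
... | inj₂ refl = ⊥-elim (p∤a d∣a)

pos-linear : ∀ {u v w z t} → u ℕ.+ v ℕ.* w ≡ z ℕ.* t → + u + + v * + w ≡ + z * + t
pos-linear {u} {v} {w} {z} {t} eq = trans (cong (λ e → + u + e) (sym (ℤP.pos-* v w)))
  (trans (sym (ℤP.pos-+ u (v ℕ.* w))) (trans (cong +_ eq) (ℤP.pos-* z t)))

mod-inverse : ∀ {p} → Prime p → ∀ a → ¬ (p ℕD.∣ a) → ∃ λ b → + a * b ≡ 1ℤ mod p
mod-inverse {p} p-prime a p∤a with coprime-Bézout (coprime-sym (prime-coprime p-prime p∤a))
... | Bézout.+- x y 1+yp≡xa = + x , mod-intro (divides (+ y) (begin
      + a * + x - 1ℤ                 ≡⟨ cong (_- 1ℤ) (ℤP.*-comm (+ a) (+ x)) ⟩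
      + x * + a - 1ℤ                 ≡⟨ cong (_- 1ℤ) (sym (pos-linear {1} {y} {p} {x} {a} 1+yp≡xa)) ⟩
      (1ℤ + + y * + p) - 1ℤ          ≡⟨ drop-one (+ y * + p) ⟩
      + y * + p                      ∎))
  where open ≡-Reasoning
... | Bézout.-+ x y 1+xa≡yp = - + x , mod-intro (divides (- + y) (begin
      + a * - + x - 1ℤ               ≡⟨ negate (+ a) (+ x) ⟩
      - (1ℤ + + x * + a)             ≡⟨ cong -_ (pos-linear {1} {x} {a} {y} {p} 1+xa≡yp) ⟩
      - (+ y * + p)                  ≡⟨ ℤP.neg-distribˡ-* (+ y) (+ p) ⟩
      - + y * + p                    ∎))
  where open ≡-Reasoning
        negate : ∀ a x → a * - x - 1ℤ ≡ - (1ℤ + x * a)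
        negate = solve-∀

mod-cancel : ∀ {p x c} → Prime p → ¬ (+ p ∣ c) → x * c ≡ c mod p → x ≡ 1ℤ mod p
mod-cancel {p} {x} {c} p-prime p∤c (mod-intro p∣xc-c) =
  [ mod-intro , (λ p∣c → ⊥-elim (p∤c p∣c)) ]′
    (euclidℤ p-prime (x - 1ℤ) c (subst (+ p ∣_) (factor x c) p∣xc-c))
  where
  factor : ∀ x c → x * c - c ≡ (x - 1ℤ) * c
  factor = solve-∀

module _ (n : ℕ) where
  open import Algebra.Properties.CommutativeMonoid.Sum (ℤ*-mod n) using (sum)
  open import Algebra.Properties.CommutativeMonoid.Mult (ℤ*-mod n) using () renaming (_×_ to _·_)

  multiple-is-power : ∀ e x → e · x ≡ x ^ e
  multiple-is-power zero    x = refl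
  multiple-is-power (suc e) x = cong (x *_) (multiple-is-power e x)

  prime∤product : Prime n → ∀ {m} (f : Fin m → ℤ) → (∀ i → ¬ (+ n ∣ f i)) → ¬ (+ n ∣ sum f)
  prime∤product n-prime {zero}  f n∤f n∣1 = ¬prime[1] (subst Prime (ℕD.∣1⇒≡1 (∣⇒∣ᵤ n∣1)) n-prime)
  prime∤product n-prime {suc m} f n∤f n∣prod with euclidℤ n-prime (f Fin.zero) (sum (λ i → f (Fin.suc i))) n∣prod
  ... | inj₁ n∣head = n∤f Fin.zero n∣head
  ... | inj₂ n∣tail = prime∤product n-prime (λ i → f (Fin.suc i)) (λ i → n∤f (Fin.suc i)) n∣tail

-- Multiplication by a permutes the residues
-- modulo p and fixes 0, hence permutes the nonzero residues 1, …, p-1;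
-- so their product P satisfies P ≡ a^(p-1) P, and P is prime to p.
fermat : ∀ {N} → Prime (suc N) → ∀ a → ¬ (suc N ℕD.∣ a) → (+ a) ^ N ≡ 1ℤ mod suc N
fermat {N} p-prime a p∤a =
  mod-cancel p-prime (prime∤product p p-prime nonzero nonzero-unit)
    (mod-trans (mod-reflexive (cong (_* residue-product) (sym (multiple-is-power p N (+ a)))))
      (mod-sym (product-of-translates (ℤ*-mod p) nonzero times-a-on-nonzero (+ a) shift)))
  where
  p : ℕ
  p = suc N
  open Residue p
  open import Algebra.Properties.CommutativeMonoid.Sum (ℤ*-mod p) using (sum)

  b : ℤ
  b = proj₁ (mod-inverse p-prime a p∤a)
  ab≡1 : + a * b ≡ 1ℤ mod p
  ab≡1 = proj₂ (mod-inverse p-prime a p∤a)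

  undo : ∀ {u w} → u * w ≡ 1ℤ mod p → ∀ j → residue (u * + toℕ (residue (w * + toℕ j))) ≡ j
  undo {u} {w} uw≡1 j = trans (residue-cong (mod-trans (mod-* (mod-refl {a = u}) (residue-≡ (w * + toℕ j)))
    (mod-trans (mod-reflexive (sym (ℤP.*-assoc u w (+ toℕ j))))
      (mod-trans (mod-* uw≡1 mod-refl) (mod-reflexive (ℤP.*-identityˡ (+ toℕ j)))))))
    (residue-toℕ j)

  times-a : Permutation p p
  times-a = permutation (λ i → residue (+ a * + toℕ i)) (λ j → residue (b * + toℕ j))
              (undo {+ a} {b} ab≡1) (undo {b} {+ a} (mod-trans (mod-reflexive (ℤP.*-comm b (+ a))) ab≡1))

  fixes-zero : times-a ⟨$⟩ʳ Fin.zero ≡ Fin.zero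
  fixes-zero = trans (residue-cong (mod-reflexive (ℤP.*-zeroʳ (+ a)))) (residue-toℕ Fin.zero)

  times-a-on-nonzero : Permutation N N
  times-a-on-nonzero = remove Fin.zero times-a

  nonzero : Fin N → ℤ
  nonzero j = + suc (toℕ j)

  nonzero-unit : ∀ j → ¬ (+ p ∣ nonzero j)
  nonzero-unit j p∣j+1 = ℕD.>⇒∤ (s≤s (FinP.toℕ<n j)) (∣⇒∣ᵤ p∣j+1)

  shift : ∀ j → nonzero (times-a-on-nonzero ⟨$⟩ʳ j) ≡ + a * nonzero j mod p
  shift j = subst (λ r → + r ≡ + a * nonzero j mod p) (cong toℕ lifted) (residue-≡ (+ a * nonzero j))
    where
    lifted : times-a ⟨$⟩ʳ Fin.suc j ≡ Fin.suc (times-a-on-nonzero ⟨$⟩ʳ j)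
    lifted = trans (punchIn-permute times-a Fin.zero j)
                   (cong (λ z → punchIn z (times-a-on-nonzero ⟨$⟩ʳ j)) fixes-zero)

  residue-product : ℤ
  residue-product = sum nonzero

-- Polynomials over ℤ as coefficient lists, constant term first.
eval : List ℤ → ℤ → ℤ
eval []       x = 0ℤ
eval (c ∷ cs) x = c + x * eval cs x

-- Synthetic division by X - r: if D is a polynomial, then
-- X D(X) - r D(r) = (X - r) Q(X) with Q = quotient r D.
quotient : ℤ → List ℤ → List ℤ
quotient r []       = []
quotient r (e ∷ es) = eval (e ∷ es) r ∷ quotient r es

quotient-length : ∀ r ds → length (quotient r ds) ≡ length ds
quotient-length r []       = refl
quotient-length r (e ∷ es) = cong suc (quotient-length r es)

division : ∀ r x ds → x * eval ds x - r * eval ds r ≡ (x - r) * eval (quotient r ds) x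
division r x []       = solve₀ x r
  where solve₀ : ∀ x r → x * 0ℤ - r * 0ℤ ≡ (x - r) * 0ℤ
        solve₀ = solve-∀
division r x (e ∷ es) = begin
    x * (e + x * E) - r * (e + r * E′)              ≡⟨ regroup x r e E E′ ⟩
    (x - r) * (e + r * E′) + x * (x * E - r * E′)   ≡⟨ cong (λ z → (x - r) * (e + r * E′) + x * z) (division r x es) ⟩
    (x - r) * (e + r * E′) + x * ((x - r) * Q)      ≡⟨ collect x r e E′ Q ⟩
    (x - r) * ((e + r * E′) + x * Q)                ∎
  where
  open ≡-Reasoning
  E E′ Q : ℤ
  E = eval es x
  E′ = eval es r
  Q = eval (quotient r es) x
  regroup : ∀ x r e E E′ → x * (e + x * E) - r * (e + r * E′) ≡ (x - r) * (e + r * E′) + x * (x * E - r * E′)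
  regroup = solve-∀
  collect : ∀ x r e E′ Q → (x - r) * (e + r * E′) + x * ((x - r) * Q) ≡ (x - r) * ((e + r * E′) + x * Q)
  collect = solve-∀

eval-divisible : ∀ {d} cs x → All (d ∣_) cs → d ∣ eval cs x
eval-divisible []       x []       = divides 0ℤ refl
eval-divisible (c ∷ cs) x (d∣c ∷ d∣cs) = ∣m∣n⇒∣m+n d∣c (∣n⇒∣m*n x (eval-divisible cs x d∣cs))

private
  constant-term : ∀ c r D → (c + r * D) - r * D ≡ c
  constant-term = solve-∀

quotient-divisible⇒divisible : ∀ {d} r ds → All (d ∣_) (quotient r ds) → All (d ∣_) ds
quotient-divisible⇒divisible r []       []         = []
quotient-divisible⇒divisible r (e ∷ es) (d∣f ∷ d∣q) =
  subst (_ ∣_) (constant-term e r (eval es r)) (∣m∣n⇒∣m-n d∣f (∣n⇒∣m*n r (eval-divisible es r d∣es))) ∷ d∣es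
  where d∣es = quotient-divisible⇒divisible r es d∣q

root-bound : ∀ {p} → Prime p → ∀ cs rs → length cs ≤ length rs →
  All (λ r → + p ∣ eval cs r) rs → AllPairs (λ r s → ¬ (r ≡ s mod p)) rs → All (+ p ∣_) cs
root-bound p-prime []       rs        _         _          _ = []
root-bound {p} p-prime (c ∷ ds) (r ∷ rs) (s≤s len) (p∣f[r] ∷ p∣f[rs]) (r≢rs ∷ distinct) =
  subst (_ ∣_) (constant-term c r (eval ds r)) (∣m∣n⇒∣m-n p∣f[r] (∣n⇒∣m*n r (eval-divisible ds r p∣ds))) ∷ p∣ds
  where
  -- every other root s is a root of the quotient, since f(s) - f(r) = (s - r) Q(s)
  quotient-root : ∀ {s} → + p ∣ eval (c ∷ ds) s → ¬ (r ≡ s mod p) → + p ∣ eval (quotient r ds) s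
  quotient-root {s} p∣f[s] r≢s =
    [ (λ p∣s-r → ⊥-elim (r≢s (mod-sym (mod-intro p∣s-r)))) , (λ p∣q → p∣q) ]′
      (euclidℤ p-prime (s - r) (eval (quotient r ds) s)
        (subst (+ p ∣_) (trans (difference c s r (eval ds s) (eval ds r)) (division r s ds)) (∣m∣n⇒∣m-n p∣f[s] p∣f[r])))
    where
    difference : ∀ c s r E E′ → (c + s * E) - (c + r * E′) ≡ s * E - r * E′
    difference = solve-∀
  quotient-roots : ∀ {ss} → All (λ s → + p ∣ eval (c ∷ ds) s) ss → All (λ s → ¬ (r ≡ s mod p)) ss →
    All (λ s → + p ∣ eval (quotient r ds) s) ss
  quotient-roots []         []          = []
  quotient-roots (h ∷ hs) (n ∷ ns) = quotient-root h n ∷ quotient-roots hs ns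
  p∣ds : All (+ p ∣_) ds
  p∣ds = quotient-divisible⇒divisible r ds
    (root-bound p-prime (quotient r ds) rs (subst (_≤ length rs) (sym (quotient-length r ds)) len)
      (quotient-roots p∣f[rs] r≢rs) distinct)

monomial : ℕ → List ℤ
monomial zero    = 1ℤ ∷ []
monomial (suc e) = 0ℤ ∷ monomial e

monomial-eval : ∀ e x → eval (monomial e) x ≡ x ^ e
monomial-eval zero    x = cong (λ z → 1ℤ + z) (ℤP.*-zeroʳ x)
monomial-eval (suc e) x = trans (ℤP.+-identityˡ _) (cong (x *_) (monomial-eval e x))

monomial-length : ∀ e → length (monomial e) ≡ suc e
monomial-length zero    = refl
monomial-length (suc e) = cong suc (monomial-length e)

monomial-nonzero : ∀ {p} → Prime p → ∀ e → ¬ All (+ p ∣_) (monomial e)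
monomial-nonzero p-prime zero    (p∣1 ∷ []) = ¬prime[1] (subst Prime (ℕD.∣1⇒≡1 (∣⇒∣ᵤ p∣1)) p-prime)
monomial-nonzero p-prime (suc e) (_ ∷ p∣cs) = monomial-nonzero p-prime e p∣cs

candidates : ℕ → List ℤ
candidates zero    = []
candidates (suc n) = + suc n ∷ candidates n

candidates-length : ∀ n → length (candidates n) ≡ n
candidates-length zero    = refl
candidates-length (suc n) = cong suc (candidates-length n)

candidates-distinct : ∀ {p} n → n < p → AllPairs (λ r s → ¬ (r ≡ s mod p)) (candidates n)
candidates-distinct zero    _   = []
candidates-distinct (suc n) n<p = head-distinct n ℕP.≤-refl ∷ candidates-distinct n (ℕP.<-trans (ℕP.n<1+n n) n<p)
  where
  head-distinct : ∀ m → m < suc n → All (λ s → ¬ (+ suc n ≡ s mod _)) (candidates m)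
  head-distinct zero    _   = []
  head-distinct (suc m) m<n = small-incongruent m<n n<p ∷ head-distinct m (ℕP.<-trans (ℕP.n<1+n m) m<n)

search : ∀ (P : ℤ → Set) → (∀ x → Dec (P x)) → ∀ n →
  All P (candidates n) ⊎ ∃ λ x → 0 < x × x ≤ n × ¬ P (+ x)
search P P? zero = inj₁ []
search P P? (suc n) with P? (+ suc n) | search P P? n
... | no ¬P[n+1] | _                          = inj₂ (suc n , s≤s z≤n , ℕP.≤-refl , ¬P[n+1])
... | yes P[n+1] | inj₁ all                   = inj₁ (P[n+1] ∷ all)
... | yes _      | inj₂ (x , 0<x , x≤n , ¬Px) = inj₂ (x , 0<x , ℕP.m≤n⇒m≤1+n x≤n , ¬Px)

-- Modulo a prime p, X^e ≡ 1 (e > 0) cannot hold for all of 1, …, e + 1 < p: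
-- otherwise X^e - 1 would vanish modulo p by Lagrange's bound.
non-root : ∀ {p} → Prime p → ∀ e → .{{NonZero e}} → suc e < p →
  ∃ λ x → 0 < x × x < p × ¬ ((+ x) ^ e ≡ 1ℤ mod p)
non-root {p} p-prime (suc e) e+2<p = conclude (search (λ x → x ^ suc e ≡ 1ℤ mod p) decide (suc (suc e)))
  where
  decide : ∀ x → Dec (x ^ suc e ≡ 1ℤ mod p)
  decide x = Dec.map′ mod-intro n∣a-b (+ p ∣? (x ^ suc e - 1ℤ))
  X^[e+1]-1 : List ℤ
  X^[e+1]-1 = - 1ℤ ∷ monomial e
  eval-X^[e+1]-1 : ∀ x → eval X^[e+1]-1 x ≡ x ^ suc e - 1ℤ
  eval-X^[e+1]-1 x = trans (cong (λ z → - 1ℤ + x * z) (monomial-eval e x)) (ℤP.+-comm (- 1ℤ) (x ^ suc e))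
  length-ok : length X^[e+1]-1 ≤ length (candidates (suc (suc e)))
  length-ok = ℕP.≤-reflexive (trans (cong suc (monomial-length e)) (sym (candidates-length (suc (suc e)))))
  as-roots : ∀ {xs} → All (λ x → x ^ suc e ≡ 1ℤ mod p) xs → All (λ x → + p ∣ eval X^[e+1]-1 x) xs
  as-roots []         = []
  as-roots {x ∷ _} (x-root ∷ roots) = subst (+ p ∣_) (sym (eval-X^[e+1]-1 x)) (n∣a-b x-root) ∷ as-roots roots
  drop-constant : ∀ {c cs} → All (+ p ∣_) (c ∷ cs) → All (+ p ∣_) cs
  drop-constant (_ ∷ p∣cs) = p∣cs
  conclude : All (λ x → x ^ suc e ≡ 1ℤ mod p) (candidates (suc (suc e))) ⊎ (∃ λ x → 0 < x × x ≤ suc (suc e) × ¬ ((+ x) ^ suc e ≡ 1ℤ mod p)) →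
    ∃ λ x → 0 < x × x < p × ¬ ((+ x) ^ suc e ≡ 1ℤ mod p)
  conclude (inj₂ (x , 0<x , x≤e+2 , ¬root)) = x , 0<x , ℕP.≤-<-trans x≤e+2 e+2<p , ¬root
  conclude (inj₁ all-roots) = ⊥-elim (monomial-nonzero p-prime e (drop-constant
    (root-bound p-prime X^[e+1]-1 (candidates (suc (suc e))) length-ok (as-roots all-roots)
      (candidates-distinct (suc (suc e)) e+2<p))))

proper-divisor-of-prime-power : ∀ {q} → Prime q → ∀ b {g} →
  g ℕD.∣ q ℕ.^ suc b → g ≢ q ℕ.^ suc b → g ℕD.∣ q ℕ.^ b
proper-divisor-of-prime-power {q} q-prime b {g} g∣q^[b+1] g≢q^[b+1] with q ℕD.∣? g
... | no q∤g = coprime-divisor (coprime-sym (prime-coprime q-prime q∤g)) g∣q^[b+1]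
... | yes (ℕD.divides g′ refl) = shrink b g∣q^[b+1] g≢q^[b+1]
  where
  instance _ = prime⇒nonZero q-prime
  -- writing g = g′ q, the cofactor g′ is a proper divisor of q^b
  shrink : ∀ b → g′ ℕ.* q ℕD.∣ q ℕ.^ suc b → g′ ℕ.* q ≢ q ℕ.^ suc b → g′ ℕ.* q ℕD.∣ q ℕ.^ b
  cofactor : ∀ b → g′ ℕ.* q ℕD.∣ q ℕ.^ suc b → g′ ℕD.∣ q ℕ.^ b
  cofactor b g∣ = ℕD.*-cancelʳ-∣ q (subst (g′ ℕ.* q ℕD.∣_) (ℕP.*-comm q (q ℕ.^ b)) g∣)
  shrink zero     g∣ g≢ = ⊥-elim (g≢ (trans (cong (ℕ._* q) (ℕD.∣1⇒≡1 (cofactor zero g∣)))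
                                      (trans (ℕP.*-identityˡ q) (sym (ℕP.*-identityʳ q)))))
  shrink (suc b′) g∣ g≢ = subst (g′ ℕ.* q ℕD.∣_) (ℕP.*-comm (q ℕ.^ b′) q)
    (ℕD.*-monoˡ-∣ q (proper-divisor-of-prime-power q-prime b′ (cofactor (suc b′) g∣)
      (λ g′≡ → g≢ (trans (cong (ℕ._* q) g′≡) (ℕP.*-comm (q ℕ.^ suc b′) q)))))

-- Orders of elements of a commutative monoid, whose n-th power of x is
-- the library's n-fold product n · x.  Used both for ℤ*-mod p and for G.
module Orders {c ℓ} (M : CommutativeMonoid c ℓ) where
  open CommutativeMonoid M
    using (Carrier; _≈_; _∙_; ε; setoid; ∙-cong; ∙-congˡ; identityˡ; identityʳ; comm)
    renaming (refl to ≈-refl; trans to ≈-trans)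
  open import Algebra.Properties.CommutativeMonoid.Mult M
    using (×-congʳ; ×-congˡ; ×-homo-+; ×-assocˡ; ×-distrib-+) renaming (_×_ to _·_)
  open import Relation.Binary.Reasoning.Setoid setoid

  ·-ε : ∀ n → n · ε ≈ ε
  ·-ε zero    = ≈-refl
  ·-ε (suc n) = ≈-trans (identityˡ (n · ε)) (·-ε n)

  killed-by-multiples : ∀ n {j x} → n · x ≈ ε → n ℕD.∣ j → j · x ≈ ε
  killed-by-multiples n {x = x} nx≈ε (ℕD.divides c ≡.refl) = begin
    (c ℕ.* n) · x  ≈⟨ ×-assocˡ x c n ⟨
    c · (n · x)    ≈⟨ ×-congʳ c nx≈ε ⟩
    c · ε          ≈⟨ ·-ε c ⟩
    ε              ∎

  killed-by-difference : ∀ d u {x} → (d ℕ.+ u) · x ≈ ε → u · x ≈ ε → d · x ≈ ε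
  killed-by-difference d u {x} [d+u]x≈ε ux≈ε = begin
    d · x            ≈⟨ identityʳ (d · x) ⟨
    d · x ∙ ε        ≈⟨ ∙-congˡ ux≈ε ⟨
    d · x ∙ u · x    ≈⟨ ×-homo-+ x d u ⟨
    (d ℕ.+ u) · x    ≈⟨ [d+u]x≈ε ⟩
    ε                ∎

  killed-by-gcd : ∀ {d i j x} → Bézout.Identity d i j → i · x ≈ ε → j · x ≈ ε → d · x ≈ ε
  killed-by-gcd {d} {i} {j} (Bézout.+- a b d+bj≡ai) ix≈ε jx≈ε =
    killed-by-difference d (b ℕ.* j) (≈-trans (×-congˡ d+bj≡ai) (killed-by-multiples i ix≈ε (ℕD.n∣m*n a)))
      (killed-by-multiples j jx≈ε (ℕD.n∣m*n b))
  killed-by-gcd {d} {i} {j} (Bézout.-+ a b d+ai≡bj) ix≈ε jx≈ε =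
    killed-by-difference d (a ℕ.* i) (≈-trans (×-congˡ d+ai≡bj) (killed-by-multiples j jx≈ε (ℕD.n∣m*n b)))
      (killed-by-multiples i ix≈ε (ℕD.n∣m*n a))

  record HasOrder (x : Carrier) (n : ℕ) : Set ℓ where
    field
      returns : n · x ≈ ε
      minimal : ∀ i → 0 < i → i < n → ¬ (i · x ≈ ε)
  open HasOrder public

  order-divides : ∀ {x n} → .{{NonZero n}} → HasOrder x n → ∀ j → j · x ≈ ε → n ℕD.∣ j
  order-divides {x} {n} ord j jx≈ε with j ℕ.% n ℕ.≟ 0
  ... | yes j%n≡0 = ℕD.m%n≡0⇒n∣m j n j%n≡0
  ... | no  j%n≢0 = ⊥-elim (minimal ord (j ℕ.% n) (ℕP.n≢0⇒n>0 j%n≢0) (ℕDM.m%n<n j n)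
          (killed-by-difference (j ℕ.% n) (j ℕ./ n ℕ.* n) (≈-trans (×-congˡ (≡.sym (ℕDM.m≡m%n+[m/n]*n j n))) jx≈ε)
            (killed-by-multiples n (returns ord) (ℕD.n∣m*n (j ℕ./ n)))))

  order-of-factor-divides : ∀ {x y n o} → .{{NonZero n}} → HasOrder x n → Coprime n o →
    o · y ≈ ε → ∀ i → i · (x ∙ y) ≈ ε → n ℕD.∣ i
  order-of-factor-divides {x} {y} {n} {o} ord cop oy≈ε i i[xy]≈ε =
    coprime-divisor cop (≡.subst (n ℕD.∣_) (ℕP.*-comm i o) (order-divides ord (i ℕ.* o) io·x≈ε))
    where
    io·x≈ε : (i ℕ.* o) · x ≈ ε
    io·x≈ε = begin
      (i ℕ.* o) · x                  ≈⟨ identityʳ _ ⟨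
      (i ℕ.* o) · x ∙ ε              ≈⟨ ∙-congˡ (killed-by-multiples o oy≈ε (ℕD.n∣m*n i)) ⟨
      (i ℕ.* o) · x ∙ (i ℕ.* o) · y  ≈⟨ ×-distrib-+ x y (i ℕ.* o) ⟨
      (i ℕ.* o) · (x ∙ y)            ≈⟨ killed-by-multiples i i[xy]≈ε (ℕD.m∣m*n o) ⟩
      ε                              ∎

  order-product : ∀ {x y a c} → .{{NonZero a}} → .{{NonZero c}} →
    HasOrder x a → HasOrder y c → Coprime a c → HasOrder (x ∙ y) (a ℕ.* c)
  order-product {x} {y} {a} {c} ord-x ord-y cop = record
    { returns = begin
        (a ℕ.* c) · (x ∙ y)            ≈⟨ ×-distrib-+ x y (a ℕ.* c) ⟩
        (a ℕ.* c) · x ∙ (a ℕ.* c) · y  ≈⟨ ∙-cong (killed-by-multiples a (returns ord-x) (ℕD.m∣m*n c))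
                                                 (killed-by-multiples c (returns ord-y) (ℕD.n∣m*n a)) ⟩
        ε ∙ ε                          ≈⟨ identityˡ ε ⟩
        ε                              ∎
    ; minimal = λ i 0<i i<ac i[xy]≈ε → ℕP.<⇒≱ i<ac (ℕD.∣⇒≤ {{ℕ.>-nonZero 0<i}} (coprime-divisors cop
        (order-of-factor-divides ord-x cop (returns ord-y) i i[xy]≈ε)
        (order-of-factor-divides ord-y (coprime-sym cop) (returns ord-x) i
          (≈-trans (×-congʳ i (comm y x)) i[xy]≈ε))))
    }

  prime-power-order : ∀ {x q} → Prime q → ∀ b →
    (q ℕ.^ suc b) · x ≈ ε → ¬ ((q ℕ.^ b) · x ≈ ε) → HasOrder x (q ℕ.^ suc b)
  prime-power-order {x} {q} q-prime b Q·x≈ε q^b·x≉ε = record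
    { returns = Q·x≈ε
    ; minimal = λ i 0<i i<Q ix≈ε → q^b·x≉ε (gcd-argument i 0<i i<Q ix≈ε (Bézout.lemma i Q))
    }
    where
    Q : ℕ
    Q = q ℕ.^ suc b
    -- g = gcd i Q satisfies x^g ≈ 1 and is a proper divisor of Q
    gcd-argument : ∀ i → 0 < i → i < Q → i · x ≈ ε → Bézout.Lemma i Q → (q ℕ.^ b) · x ≈ ε
    gcd-argument i 0<i i<Q ix≈ε (Bézout.result g g-gcd identity) =
      killed-by-multiples g (killed-by-gcd identity ix≈ε Q·x≈ε)
        (proper-divisor-of-prime-power q-prime b (GCD.GCD.gcd∣n g-gcd)
          (λ g≡Q → ℕP.<-irrefl g≡Q (ℕP.≤-<-trans (ℕD.∣⇒≤ {{ℕ.>-nonZero 0<i}} (GCD.GCD.gcd∣m g-gcd)) i<Q)))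

prime-factor : ∀ n → 1 < n → ∃ λ q → Prime q × q ℕD.∣ n
prime-factor n 1<n with factorise n {{ℕ.>-nonZero (ℕP.<-trans (s≤s z≤n) 1<n)}}
... | record { factors = [] ; isFactorisation = n≡1 } = ⊥-elim (ℕP.<-irrefl (sym n≡1) 1<n)
... | record { factors = q ∷ qs ; isFactorisation = n≡q*qs ; factorsPrime = q-prime ∷ _ } =
  q , q-prime , subst (q ℕD.∣_) (sym n≡q*qs) (ℕD.m∣m*n (product qs))

prime-power-coprime : ∀ {q e} → Prime q → ¬ (q ℕD.∣ e) → ∀ a → Coprime (q ℕ.^ a) e
prime-power-coprime {q} {e} q-prime q∤e a {d} (d∣q^a , d∣e) = ℕD.∣1⇒≡1 (divides-one a d∣q^a)
  where
  d-coprime-q : Coprime d q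
  d-coprime-q = coprime-sym (prime-coprime q-prime (λ q∣d → q∤e (ℕD.∣-trans q∣d d∣e)))
  divides-one : ∀ a → d ℕD.∣ q ℕ.^ a → d ℕD.∣ 1
  divides-one zero    d∣1       = d∣1
  divides-one (suc a) d∣q^[a+1] = divides-one a (coprime-divisor d-coprime-q d∣q^[a+1])

split-off : ∀ {q} → 1 < q → ∀ n → 0 < n → ∃ λ a → ∃ λ e → n ≡ q ℕ.^ a ℕ.* e × ¬ (q ℕD.∣ e)
split-off {q} 1<q = <-rec (λ n → 0 < n → ∃ λ a → ∃ λ e → n ≡ q ℕ.^ a ℕ.* e × ¬ (q ℕD.∣ e)) step
  where
  step : ∀ n → (∀ {m} → m < n → 0 < m → ∃ λ a → ∃ λ e → m ≡ q ℕ.^ a ℕ.* e × ¬ (q ℕD.∣ e)) →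
    0 < n → ∃ λ a → ∃ λ e → n ≡ q ℕ.^ a ℕ.* e × ¬ (q ℕD.∣ e)
  step n split-smaller 0<n with q ℕD.∣? n
  ... | no q∤n = 0 , n , sym (ℕP.+-identityʳ n) , q∤n
  ... | yes (ℕD.divides zero n≡0)    = ⊥-elim (ℕP.<-irrefl (sym n≡0) 0<n)
  ... | yes (ℕD.divides (suc m) n≡m*q) with split-smaller (subst (suc m <_) (sym n≡m*q) (ℕP.m<m*n (suc m) q 1<q)) (s≤s z≤n)
  ...   | a , e , m≡q^a*e , q∤e = suc a , e , trans n≡m*q (trans (cong (ℕ._* q) m≡q^a*e) (reassociate q (q ℕ.^ a) e)) , q∤e
    where
    reassociate : ∀ q A e → A ℕ.* e ℕ.* q ≡ q ℕ.* A ℕ.* e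
    reassociate = ℕSolver.solve-∀

HasOrderMod : ℕ → ℤ → ℕ → Set
HasOrderMod m = Orders.HasOrder (ℤ*-mod m)

prime>1 : ∀ {p} → Prime p → 1 < p
prime>1 {p} p-prime = ℕ.nonTrivial⇒n>1 p {{prime⇒nonTrivial p-prime}}

-- Modulo a prime p, every prime power q^(b+1) dividing p - 1 is an order:
-- write p - 1 = e q^(b+1); Lagrange's bound gives x with x^(e q^b) ≢ 1,
-- while x^(p-1) ≡ 1 by Fermat, so x^e has order q^(b+1).
prime-power-order-exists : ∀ {N q} → Prime (suc N) → Prime q → ∀ b → q ℕ.^ suc b ℕD.∣ N →
  ∃ λ y → HasOrderMod (suc N) y (q ℕ.^ suc b)
prime-power-order-exists {N} {q} p-prime q-prime b (ℕD.divides e N≡e*Q) = order-of-power (non-root p-prime D D<N)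
  where
  p D : ℕ
  p = suc N
  D = e ℕ.* q ℕ.^ b
  N≡q*D : N ≡ q ℕ.* D
  N≡q*D = trans N≡e*Q (reassociate e q (q ℕ.^ b))
    where
    reassociate : ∀ e q A → e ℕ.* (q ℕ.* A) ≡ q ℕ.* (e ℕ.* A)
    reassociate = ℕSolver.solve-∀
  instance
    D≢0 : NonZero D
    D≢0 = ℕ.≢-nonZero (λ D≡0 → ℕP.<-irrefl (sym (trans N≡q*D (trans (cong (q ℕ.*_) D≡0) (ℕP.*-zeroʳ q))))
                                             (ℕP.≤-pred (prime>1 p-prime)))
  D<N : suc D < p
  D<N = s≤s (subst (D <_) (sym N≡q*D) (ℕP.<-≤-trans (ℕP.m<m*n D q (prime>1 q-prime)) (ℕP.≤-reflexive (ℕP.*-comm D q))))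
  order-of-power : (∃ λ x → 0 < x × x < p × ¬ ((+ x) ^ D ≡ 1ℤ mod p)) → ∃ λ y → HasOrderMod p y (q ℕ.^ suc b)
  order-of-power (x , 0<x , x<p , x^D≢1) =
    (+ x) ^ e , Orders.prime-power-order (ℤ*-mod p) q-prime b
                  (subst (_≡ 1ℤ mod p) (sym (multiple-is-power p (q ℕ.^ suc b) ((+ x) ^ e))) y^Q≡1)
                  (λ y^q^b≡1 → y^q^b≢1 (subst (_≡ 1ℤ mod p) (multiple-is-power p (q ℕ.^ b) ((+ x) ^ e)) y^q^b≡1))
    where
    y^Q≡1 : ((+ x) ^ e) ^ (q ℕ.^ suc b) ≡ 1ℤ mod p
    y^Q≡1 = subst (_≡ 1ℤ mod p) (trans (cong ((+ x) ^_) N≡e*Q) (sym (ℤP.^-*-assoc (+ x) e (q ℕ.^ suc b))))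
              (fermat p-prime x (ℕD.>⇒∤ {{ℕ.>-nonZero 0<x}} x<p))
    y^q^b≢1 : ¬ (((+ x) ^ e) ^ (q ℕ.^ b) ≡ 1ℤ mod p)
    y^q^b≢1 y^q^b≡1 = x^D≢1 (subst (_≡ 1ℤ mod p) (ℤP.^-*-assoc (+ x) e (q ℕ.^ b)) y^q^b≡1)

-- Modulo a prime p, every divisor d of p - 1 is the order of some element:
-- split off the full power of a prime factor of d and multiply elements
-- of the two coprime orders.
orders-exist : ∀ {N} → Prime (suc N) → ∀ d → d ℕD.∣ N → ∃ λ y → HasOrderMod (suc N) y d
orders-exist {N} p-prime = <-rec (λ d → d ℕD.∣ N → ∃ λ y → HasOrderMod (suc N) y d) step
  where
  step : ∀ d → (∀ {d′} → d′ < d → d′ ℕD.∣ N → ∃ λ y → HasOrderMod (suc N) y d′) →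
    d ℕD.∣ N → ∃ λ y → HasOrderMod (suc N) y d
  step zero _ 0∣N = ⊥-elim (ℕP.<-irrefl (sym (ℕD.0∣⇒≡0 0∣N)) (ℕP.≤-pred (prime>1 p-prime)))
  step (suc zero) _ _ = 1ℤ , record { returns = mod-refl ; minimal = λ { i 0<i (s≤s i≤0) _ → ℕP.<⇒≱ 0<i i≤0 } }
  step d@(suc (suc _)) smaller d∣N with prime-factor d (s≤s (s≤s z≤n))
  ... | q , q-prime , q∣d with split-off (prime>1 q-prime) d (s≤s z≤n)
  ...   | zero  , e , d≡1*e , q∤e = ⊥-elim (q∤e (subst (q ℕD.∣_) (trans d≡1*e (ℕP.*-identityˡ e)) q∣d))
  ...   | suc b , zero , d≡Q*0 , _ = ⊥-elim (ℕP.1+n≢0 (trans d≡Q*0 (ℕP.*-zeroʳ (q ℕ.^ suc b))))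
  ...   | suc b , e@(suc _) , d≡Q*e , q∤e =
    proj₁ y-ord * proj₁ z-ord ,
    subst (HasOrderMod (suc N) _) (sym d≡Q*e) (Orders.order-product (ℤ*-mod (suc N)) (proj₂ y-ord) (proj₂ z-ord) (prime-power-coprime q-prime q∤e (suc b)))
    where
    Q : ℕ
    Q = q ℕ.^ suc b
    instance
      Q≢0 : NonZero Q
      Q≢0 = ℕ.>-nonZero (ℕP.m^n>0 q {{prime⇒nonZero q-prime}} (suc b))
    1<Q : 1 < Q
    1<Q = ℕP.<-≤-trans (prime>1 q-prime) (ℕP.m≤m*n q (q ℕ.^ b) {{ℕ.>-nonZero (ℕP.m^n>0 q {{prime⇒nonZero q-prime}} b)}})
    e<d : e < d
    e<d = subst (e <_) (sym d≡Q*e) (ℕP.<-≤-trans (ℕP.m<m*n e Q 1<Q) (ℕP.≤-reflexive (ℕP.*-comm e Q)))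
    y-ord : ∃ λ y → HasOrderMod (suc N) y Q
    y-ord = prime-power-order-exists p-prime q-prime b (ℕD.∣-trans (subst (Q ℕD.∣_) (sym d≡Q*e) (ℕD.m∣m*n e)) d∣N)
    z-ord : ∃ λ z → HasOrderMod (suc N) z e
    z-ord = smaller e<d (ℕD.∣-trans (subst (e ℕD.∣_) (sym d≡Q*e) (ℕD.n∣m*n Q)) d∣N)

record Multiplier (k w : ℕ) (m : ℤ) : Set where
  field
    period         : m ^ k ≡ 1ℤ mod w
    fixedPointFree : ∀ q → Prime q → q ℕD.∣ w → ∀ i → 0 < i → i < k → ¬ (m ^ i ≡ 1ℤ mod q)
open Multiplier

prime∣prime : ∀ {p q} → Prime p → Prime q → q ℕD.∣ p → q ≡ p
prime∣prime p-prime q-prime q∣p with prime⇒irreducible p-prime q∣p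
... | inj₁ q≡1 = ⊥-elim (¬prime[1] (subst Prime q≡1 q-prime))
... | inj₂ q≡p = q≡p

prime∣product : ∀ {p q w} → Prime p → Prime q → q ℕD.∣ p ℕ.* w → q ≡ p ⊎ q ℕD.∣ w
prime∣product {p} {q} {w} p-prime q-prime q∣pw with euclidsLemma p w q-prime q∣pw
... | inj₁ q∣p = inj₁ (prime∣prime p-prime q-prime q∣p)
... | inj₂ q∣w = inj₂ q∣w

multiplier-for-1 : ∀ k → Multiplier k 1 1ℤ
multiplier-for-1 k = record
  { period         = mod-intro (∣ᵤ⇒∣ (ℕD.1∣ _))
  ; fixedPointFree = λ q q-prime q∣1 → ⊥-elim (¬prime[1] (subst Prime (ℕD.∣1⇒≡1 q∣1) q-prime))
  }

multiplier-for-prime : ∀ {k p} → Prime p → k ℕD.∣ p ℕ.∸ 1 → ∃ (Multiplier k p)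
multiplier-for-prime {k} {zero}  p-prime _   = ⊥-elim (ℕP.<⇒≱ (prime>1 p-prime) z≤n)
multiplier-for-prime {k} {suc N} p-prime k∣N with orders-exist p-prime k k∣N
... | y , y-order = y , record
  { period         = subst (_≡ 1ℤ mod suc N) (multiple-is-power (suc N) k y) (Orders.returns y-order)
  ; fixedPointFree = λ q q-prime q∣p i 0<i i<k y^i≡1 →
      Orders.minimal y-order i 0<i i<k
        (subst (_≡ 1ℤ mod suc N) (sym (multiple-is-power (suc N) i y))
          (subst (y ^ i ≡ 1ℤ mod_) (prime∣prime p-prime q-prime q∣p) y^i≡1))
  }

geometric : ℤ → ℕ → ℤ
geometric Y zero    = 0ℤ
geometric Y (suc n) = 1ℤ + Y * geometric Y n

geometric-sum : ∀ Y n → Y ^ n - 1ℤ ≡ (Y - 1ℤ) * geometric Y n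
geometric-sum Y zero    = vanish Y
  where
  vanish : ∀ Y → 1ℤ - 1ℤ ≡ (Y - 1ℤ) * 0ℤ
  vanish = solve-∀
geometric-sum Y (suc n) = begin
  Y * Y ^ n - 1ℤ                         ≡⟨ expand Y (Y ^ n) ⟩
  (Y - 1ℤ) + Y * (Y ^ n - 1ℤ)            ≡⟨ cong (λ z → (Y - 1ℤ) + Y * z) (geometric-sum Y n) ⟩
  (Y - 1ℤ) + Y * ((Y - 1ℤ) * G)          ≡⟨ collect Y G ⟩
  (Y - 1ℤ) * (1ℤ + Y * G)                ∎
  where
  open ≡-Reasoning
  G : ℤ
  G = geometric Y n
  expand : ∀ Y A → Y * A - 1ℤ ≡ (Y - 1ℤ) + Y * (A - 1ℤ)
  expand = solve-∀
  collect : ∀ Y G → (Y - 1ℤ) + Y * ((Y - 1ℤ) * G) ≡ (Y - 1ℤ) * (1ℤ + Y * G)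
  collect = solve-∀

geometric-≡ : ∀ {p Y} → Y ≡ 1ℤ mod p → ∀ n → geometric Y n ≡ + n mod p
geometric-≡ Y≡1 zero    = mod-refl
geometric-≡ Y≡1 (suc n) = mod-trans (mod-+ (mod-refl {a = 1ℤ}) (mod-* Y≡1 (geometric-≡ Y≡1 n)))
                                    (mod-reflexive (cong (λ z → 1ℤ + z) (ℤP.*-identityˡ (+ n))))

-- Lifting: if Y ≡ 1 modulo w and modulo p, then Y^p ≡ 1 modulo p w,
-- since Y^p - 1 = (Y - 1)(1 + Y + … + Y^(p-1)) and the second factor is ≡ p.
lift-power : ∀ {p w Y} → Y ≡ 1ℤ mod w → Y ≡ 1ℤ mod p → Y ^ p ≡ 1ℤ mod (p ℕ.* w)
lift-power {p} {w} {Y} (mod-intro w∣Y-1) Y≡1[p] =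
  mod-intro (subst (+ (p ℕ.* w) ∣_) (sym (geometric-sum Y p)) (∣ᵤ⇒∣ pw∣product))
  where
  add-back : ∀ G P → (G - P) + P ≡ G
  add-back = solve-∀
  p∣G : + p ∣ geometric Y p
  p∣G = subst (+ p ∣_) (add-back (geometric Y p) (+ p))
          (∣m∣n⇒∣m+n (n∣a-b (geometric-≡ Y≡1[p] p)) (divides 1ℤ (sym (ℤP.*-identityˡ (+ p)))))
  pw∣product : p ℕ.* w ℕD.∣ ∣ (Y - 1ℤ) * geometric Y p ∣
  pw∣product = subst₂ ℕD._∣_ (ℕP.*-comm w p) (sym (ℤP.abs-* (Y - 1ℤ) (geometric Y p)))
                 (ℕD.*-pres-∣ (∣⇒∣ᵤ w∣Y-1) (∣⇒∣ᵤ p∣G))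

powers-agree : ∀ {k w m p} → m ^ k ≡ 1ℤ mod w → k ℕD.∣ p ℕ.∸ 1 → 1 ≤ p → ∀ i → (m ^ p) ^ i ≡ m ^ i mod w
powers-agree {k} {w} {m} {p} m^k≡1 (ℕD.divides t p∸1≡t*k) 1≤p i =
  mod-trans (mod-reflexive m^[pi]≡m^i*[m^k]^[ti])
    (mod-trans (mod-* (mod-refl {a = m ^ i}) (mod-trans (mod-^ (t ℕ.* i) m^k≡1) (mod-reflexive (ℤP.^-zeroˡ (t ℕ.* i)))))
      (mod-reflexive (ℤP.*-identityʳ (m ^ i))))
  where
  p≡1+t*k : p ≡ 1 ℕ.+ t ℕ.* k
  p≡1+t*k = trans (sym (ℕP.m+[n∸m]≡n 1≤p)) (cong (1 ℕ.+_) p∸1≡t*k)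
  exponent : ∀ i t k → (1 ℕ.+ t ℕ.* k) ℕ.* i ≡ i ℕ.+ k ℕ.* (t ℕ.* i)
  exponent = ℕSolver.solve-∀
  m^[pi]≡m^i*[m^k]^[ti] : (m ^ p) ^ i ≡ m ^ i * (m ^ k) ^ (t ℕ.* i)
  m^[pi]≡m^i*[m^k]^[ti] = begin
    (m ^ p) ^ i                       ≡⟨ ℤP.^-*-assoc m p i ⟩
    m ^ (p ℕ.* i)                     ≡⟨ cong (λ e → m ^ (e ℕ.* i)) p≡1+t*k ⟩
    m ^ ((1 ℕ.+ t ℕ.* k) ℕ.* i)       ≡⟨ cong (m ^_) (exponent i t k) ⟩
    m ^ (i ℕ.+ k ℕ.* (t ℕ.* i))       ≡⟨ ℤP.^-distribˡ-+-* m i (k ℕ.* (t ℕ.* i)) ⟩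
    m ^ i * m ^ (k ℕ.* (t ℕ.* i))     ≡⟨ cong (m ^ i *_) (sym (ℤP.^-*-assoc m k (t ℕ.* i))) ⟩
    m ^ i * (m ^ k) ^ (t ℕ.* i)       ∎
    where open ≡-Reasoning

multiplier-lift : ∀ {k w m p} → Multiplier k w m → Prime p → p ℕD.∣ w → k ℕD.∣ p ℕ.∸ 1 →
  Multiplier k (p ℕ.* w) (m ^ p)
multiplier-lift {k} {w} {m} {p} mult p-prime p∣w k∣p-1 = record
  { period = subst (_≡ 1ℤ mod p ℕ.* w) swap-exponents
      (lift-power (period mult) (mod-weaken p∣w (period mult)))
  ; fixedPointFree = λ q q-prime q∣pw i 0<i i<k [m^p]^i≡1 →
      fixedPointFree mult q q-prime (q∣w q-prime q∣pw) i 0<i i<k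
        (mod-trans (mod-sym (mod-weaken (q∣w q-prime q∣pw) (powers-agree (period mult) k∣p-1 (ℕP.<⇒≤ (prime>1 p-prime)) i)))
          [m^p]^i≡1)
  }
  where
  swap-exponents : (m ^ k) ^ p ≡ (m ^ p) ^ k
  swap-exponents = trans (ℤP.^-*-assoc m k p) (trans (cong (m ^_) (ℕP.*-comm k p)) (sym (ℤP.^-*-assoc m p k)))
  q∣w : ∀ {q} → Prime q → q ℕD.∣ p ℕ.* w → q ℕD.∣ w
  q∣w q-prime q∣pw = [ (λ q≡p → subst (ℕD._∣ w) (sym q≡p) p∣w) , (λ q∣w → q∣w) ]′ (prime∣product p-prime q-prime q∣pw)

crt : ∀ {p w t} → + w * t ≡ 1ℤ mod p → ∀ y m → ∃ λ c → c ≡ y mod p × c ≡ m mod w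
crt {p} {w} {t} wt≡1 y m = c , c≡y , c≡m
  where
  c : ℤ
  c = m + + w * (t * (y - m))
  shift : ∀ m W T → (m + W * T) - m ≡ T * W
  shift = solve-∀
  c≡m : c ≡ m mod w
  c≡m = mod-intro (divides (t * (y - m)) (shift m (+ w) (t * (y - m))))
  regroup : ∀ m W t d → m + W * (t * d) ≡ m + (W * t) * d
  regroup = solve-∀
  cancel : ∀ m y → m + 1ℤ * (y - m) ≡ y
  cancel = solve-∀
  c≡y : c ≡ y mod p
  c≡y = mod-trans (mod-reflexive (regroup m (+ w) t (y - m)))
          (mod-trans (mod-+ (mod-refl {a = m}) (mod-* wt≡1 (mod-refl {a = y - m})))
            (mod-reflexive (cancel m y)))

multiplier-glue : ∀ {k w m p y} → Multiplier k w m → Prime p → ¬ (p ℕD.∣ w) → Multiplier k p y →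
  ∃ (Multiplier k (p ℕ.* w))
multiplier-glue {k} {w} {m} {p} {y} mult-w p-prime p∤w mult-p with mod-inverse p-prime w p∤w
... | t , wt≡1 with crt wt≡1 y m
...   | c , c≡y , c≡m = c , record
  { period = mod-glue (prime-coprime p-prime p∤w)
      (mod-trans (mod-^ k c≡y) (period mult-p)) (mod-trans (mod-^ k c≡m) (period mult-w))
  ; fixedPointFree = λ q q-prime q∣pw i 0<i i<k c^i≡1 →
      [ (λ q≡p → fixedPointFree mult-p q q-prime (q∣p q≡p) i 0<i i<k
                   (mod-trans (mod-sym (mod-weaken (q∣p q≡p) (mod-^ i c≡y))) c^i≡1))
      , (λ q∣w → fixedPointFree mult-w q q-prime q∣w i 0<i i<k
                   (mod-trans (mod-sym (mod-weaken q∣w (mod-^ i c≡m))) c^i≡1))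
      ]′ (prime∣product p-prime q-prime q∣pw)
  }
  where
  q∣p : ∀ {q} → q ≡ p → q ℕD.∣ p
  q∣p refl = ℕD.∣-refl

multiplier-for-product : ∀ k ps → All Prime ps → AllPrimeFactors≡1Mod (product ps) k → ∃ (Multiplier k (product ps))
multiplier-for-product k []       []                     _ = 1ℤ , multiplier-for-1 k
multiplier-for-product k (p ∷ ps) (p-prime ∷ ps-prime) ≡1 =
  extend (p ℕD.∣? product ps) (multiplier-for-product k ps ps-prime ≡1-ps)
  where
  ≡1-ps : AllPrimeFactors≡1Mod (product ps) k
  ≡1-ps q q-prime q∣ps = ≡1 q q-prime (ℕD.∣-trans q∣ps (ℕD.n∣m*n p))
  k∣p-1 : k ℕD.∣ p ℕ.∸ 1
  k∣p-1 = ≡1 p p-prime (ℕD.m∣m*n (product ps))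
  extend : Dec (p ℕD.∣ product ps) → ∃ (Multiplier k (product ps)) → ∃ (Multiplier k (p ℕ.* product ps))
  extend (yes p∣ps) (m , mult) = m ^ p , multiplier-lift mult p-prime p∣ps k∣p-1
  extend (no  p∤ps) (m , mult) = multiplier-glue mult p-prime p∤ps (proj₂ (multiplier-for-prime p-prime k∣p-1))

multiplier-exists : ∀ v k → .{{NonZero v}} → AllPrimeFactors≡1Mod v k → ∃ (Multiplier k v)
multiplier-exists v k ≡1 = subst (λ w → ∃ (Multiplier k w)) (sym (PrimeFactorisation.isFactorisation F))
  (multiplier-for-product k (factors F) (PrimeFactorisation.factorsPrime F)
    (λ q q-prime q∣ps → ≡1 q q-prime (subst (q ℕD.∣_) (sym (PrimeFactorisation.isFactorisation F)) q∣ps)))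
  where
  F : PrimeFactorisation v
  F = factorise v

suc-≡1⇒∣ : ∀ {q u} → + suc u ≡ 1ℤ mod q → + q ∣ + u
suc-≡1⇒∣ {q} {u} (mod-intro q∣u) = subst (+ q ∣_) (drop-one (+ u)) q∣u

∣⇒suc-≡1 : ∀ {q u} → + q ∣ + u → + suc u ≡ 1ℤ mod q
∣⇒suc-≡1 {q} {u} q∣u = mod-intro (subst (+ q ∣_) (sym (drop-one (+ u))) q∣u)

pos-^ : ∀ a n → + (a ℕ.^ n) ≡ (+ a) ^ n
pos-^ a zero    = refl
pos-^ a (suc n) = trans (ℤP.pos-* a (a ℕ.^ n)) (cong (+ a *_) (pos-^ a n))

another-element : ∀ {n} → 2 ≤ n → (e : Fin n) → ∃ λ x → x ≢ e
another-element (s≤s (s≤s _)) Fin.zero    = Fin.suc Fin.zero , λ ()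
another-element (s≤s (s≤s _)) (Fin.suc _) = Fin.zero , λ ()

module _ {v : ℕ} (G : FinAbelianGroup v) where
  open FinAbelianGroup G

  private
    G-abelian : AbelianGroup 0ℓ 0ℓ
    G-abelian = record { isAbelianGroup = isAbelianGroup }
  open AbelianGroup G-abelian using (commutativeMonoid; group; assoc; identityˡ; identityʳ; inverseˡ; inverseʳ)
  open import Algebra.Properties.Group group using (identityˡ-unique; identityʳ-unique)
  open import Algebra.Properties.CommutativeMonoid.Mult commutativeMonoid
    using (×-assocˡ; ×-distrib-+) renaming (_×_ to _·_)
  open Orders commutativeMonoid using (killed-by-multiples; killed-by-gcd)

  translation : Fin v → Permutation v v
  translation g = permutation (g ∙_) (g ⁻¹ ∙_) (cancel g (g ⁻¹) (inverseʳ g)) (cancel (g ⁻¹) g (inverseˡ g))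
    where
    cancel : ∀ a b → a ∙ b ≡ ε → ∀ y → a ∙ (b ∙ y) ≡ y
    cancel a b ab≡ε y = trans (sym (assoc a b y)) (trans (cong (_∙ y) ab≡ε) (identityˡ y))

  -- Lagrange's theorem for G: v · g = ε.  The sum S of all elements is
  -- also the sum of their translates by g, which is (v · g) ∙ S.
  lagrange : ∀ g → v · g ≡ ε
  lagrange g = identityˡ-unique (v · g) (sum (λ x → x))
    (sym (product-of-translates commutativeMonoid (λ x → x) (translation g) g (λ _ → refl)))
    where open import Algebra.Properties.CommutativeMonoid.Sum commutativeMonoid using (sum)

  multiple-≡1 : 2 ≤ v → ∀ n → + n ≡ 1ℤ mod v → ∀ x → n · x ≡ x
  multiple-≡1 2≤v zero    (mod-intro v∣-1) x = ⊥-elim (ℕP.<-irrefl (sym (ℕD.∣1⇒≡1 (∣⇒∣ᵤ v∣-1))) 2≤v)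
  multiple-≡1 2≤v (suc u) n≡1 x =
    trans (cong (x ∙_) (killed-by-multiples v (lagrange x) (∣⇒∣ᵤ (suc-≡1⇒∣ n≡1)))) (identityʳ x)

  -- If no prime factor q of v has n ≡ 1 (mod q), then multiplication by
  -- n has no fixed point besides ε: (n - 1) · x = ε and v · x = ε, with
  -- n - 1 coprime to v.
  multiple-fixed-point : ∀ n → (∀ q → Prime q → q ℕD.∣ v → ¬ (+ n ≡ 1ℤ mod q)) → ∀ x → n · x ≡ x → x ≡ ε
  multiple-fixed-point zero    _     x ε≡x = sym ε≡x
  multiple-fixed-point (suc u) n≢1 x n·x≡x =
    trans (sym (identityʳ x)) (killed-by-gcd (coprime-Bézout u-coprime-v) u·x≡ε (lagrange x))
    where
    u·x≡ε : u · x ≡ ε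
    u·x≡ε = identityʳ-unique x (u · x) n·x≡x
    -- a common divisor i > 1 of u and v would have a prime factor q ∣ v with n ≡ 1 (mod q)
    u-coprime-v : Coprime u v
    u-coprime-v {zero}        (_ , 0∣v)     = ⊥-elim (Fin0-empty (subst Fin (ℕD.0∣⇒≡0 0∣v) x))
      where
      Fin0-empty : Fin 0 → ⊥
      Fin0-empty ()
    u-coprime-v {suc zero}    _             = refl
    u-coprime-v {suc (suc j)} (i∣u , i∣v) with prime-factor (suc (suc j)) (s≤s (s≤s z≤n))
    ... | q , q-prime , q∣i = ⊥-elim (n≢1 q q-prime (ℕD.∣-trans q∣i i∣v) (∣⇒suc-≡1 (∣ᵤ⇒∣ (ℕD.∣-trans q∣i i∣u))))

  module PowersOfMultiplier (k : ℕ) .{{_ : NonZero k}} (M : ℕ)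
    (periodic : ∀ x → (M ℕ.^ k) · x ≡ x)
    (fixed-point-free : ∀ i → 0 < i → i < k → ∀ x → (M ℕ.^ i) · x ≡ x → x ≡ ε) where

    power : ℕ → Fin v → Fin v
    power n x = (M ℕ.^ n) · x

    power-+ : ∀ a b x → power a (power b x) ≡ power (a ℕ.+ b) x
    power-+ a b x = trans (×-assocˡ x (M ℕ.^ a) (M ℕ.^ b)) (cong (_· x) (sym (ℕP.^-distribˡ-+-* M a b)))

    power-0 : ∀ x → power 0 x ≡ x
    power-0 = identityʳ

    power-periodic : ∀ c x → power (c ℕ.* k) x ≡ x
    power-periodic zero    x = power-0 x
    power-periodic (suc c) x = trans (sym (power-+ k (c ℕ.* k) x)) (trans (cong (power k) (power-periodic c x)) (periodic x))

    index : ℕ → Fin k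
    index n = fromℕ< (ℕDM.m%n<n n k)

    power-index : ∀ n x → power (toℕ (index n)) x ≡ power n x
    power-index n x = begin
      power (toℕ (index n)) x                    ≡⟨ cong (λ e → power e x) (FinP.toℕ-fromℕ< (ℕDM.m%n<n n k)) ⟩
      power (n ℕ.% k) x                          ≡⟨ cong (power (n ℕ.% k)) (power-periodic (n ℕ./ k) x) ⟨
      power (n ℕ.% k) (power (n ℕ./ k ℕ.* k) x)  ≡⟨ power-+ (n ℕ.% k) (n ℕ./ k ℕ.* k) x ⟩
      power (n ℕ.% k ℕ.+ n ℕ./ k ℕ.* k) x        ≡⟨ cong (λ e → power e x) (ℕDM.m≡m%n+[m/n]*n n k) ⟨
      power n x                                  ∎
      where open ≡-Reasoning

    power-inverse : ∀ i → i ≤ k → ∀ x → power (k ℕ.∸ i) (power i x) ≡ x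
    power-inverse i i≤k x = trans (power-+ (k ℕ.∸ i) i x) (trans (cong (λ e → power e x) (ℕP.m∸n+n≡m i≤k)) (periodic x))

    power-inverse′ : ∀ i → i ≤ k → ∀ x → power i (power (k ℕ.∸ i) x) ≡ x
    power-inverse′ i i≤k x = trans (power-+ i (k ℕ.∸ i) x) (trans (cong (λ e → power e x) (ℕP.m+[n∸m]≡n i≤k)) (periodic x))

    power-injective : ∀ i → i ≤ k → ∀ {x y} → power i x ≡ power i y → x ≡ y
    power-injective i i≤k {x} {y} same = trans (sym (power-inverse i i≤k x))
      (trans (cong (power (k ℕ.∸ i)) same) (power-inverse i i≤k y))

    apart : ∀ {x₀} → x₀ ≢ ε → ∀ {a b} → a < b → b < k → power a x₀ ≢ power b x₀
    apart {x₀} x₀≢ε {a} {b} a<b b<k same =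
      x₀≢ε (fixed-point-free (b ℕ.∸ a) (ℕP.m<n⇒0<n∸m a<b) (ℕP.≤-<-trans (ℕP.m∸n≤m b a) b<k) x₀ (sym x₀≡))
      where
      x₀≡ : x₀ ≡ power (b ℕ.∸ a) x₀
      x₀≡ = power-injective a (ℕP.<⇒≤ (ℕP.<-trans a<b b<k)) (trans same
              (trans (cong (λ e → power e x₀) (sym (ℕP.m+[n∸m]≡n (ℕP.<⇒≤ a<b)))) (sym (power-+ a (b ℕ.∸ a) x₀))))

    A : Fin k → Fin v → Fin v
    A i = power (toℕ i)

    toℕ≤k : ∀ (i : Fin k) → toℕ i ≤ k
    toℕ≤k i = ℕP.<⇒≤ (FinP.toℕ<n i)

    -- multiplication maps are homomorphisms as G is abelian, and are
    -- invertible with inverse power (k - i)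
    automorphism : ∀ i → IsAutomorphism G (A i)
    automorphism i = (λ x y → ×-distrib-+ x y (M ℕ.^ toℕ i))
                   , power-injective (toℕ i) (toℕ≤k i)
                   , (λ y → power (k ℕ.∸ toℕ i) y , λ { refl → power-inverse′ (toℕ i) (toℕ≤k i) y })

    distinct : ∀ {x₀} → x₀ ≢ ε → ∀ i j → _≐_ G (A i) (A j) → i ≡ j
    distinct {x₀} x₀≢ε i j Ai≐Aj with ℕP.<-cmp (toℕ i) (toℕ j)
    ... | tri< i<j _ _ = ⊥-elim (apart x₀≢ε i<j (FinP.toℕ<n j) (Ai≐Aj x₀))
    ... | tri≈ _ i≡j _ = FinP.toℕ-injective i≡j
    ... | tri> _ _ j<i = ⊥-elim (apart x₀≢ε j<i (FinP.toℕ<n i) (sym (Ai≐Aj x₀)))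

    ferrero-pair : 1 < k → ∀ {x₀} → x₀ ≢ ε → IsFerreroPair G k A
    ferrero-pair 1<k {x₀} x₀≢ε = record
      { autGroup = record
        { auto     = automorphism
        ; distinct = distinct x₀≢ε
        ; hasId    = index 0 , λ x → trans (power-index 0 x) (power-0 x)
        ; closed∘  = λ i j → index (toℕ i ℕ.+ toℕ j) , λ x → trans (power-index _ x) (sym (power-+ (toℕ i) (toℕ j) x))
        ; closed⁻¹ = λ i → index (k ℕ.∸ toℕ i)
            , (λ x → trans (power-index _ (A i x)) (power-inverse (toℕ i) (toℕ≤k i) x))
            , (λ x → trans (cong (A i) (power-index _ x)) (power-inverse′ (toℕ i) (toℕ≤k i) x))
        }
      ; nontrivial = fromℕ< 1<k , λ A≐id → x₀≢ε (fixed-point-free 1 (s≤s z≤n) 1<k x₀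
          (trans (cong (λ e → power e x₀) (sym (FinP.toℕ-fromℕ< 1<k))) (A≐id x₀)))
      ; fpf = fixed-points
      }
      where
      fixed-points : ∀ i g → A i g ≡ g → _≐_ G (A i) (idMap G) ⊎ g ≡ ε
      fixed-points i g Aig≡g with toℕ i ℕ.≟ 0
      ... | yes i≡0 = inj₁ (λ x → trans (cong (λ e → power e x) i≡0) (power-0 x))
      ... | no  i≢0 = inj₂ (fixed-point-free (toℕ i) (ℕP.n≢0⇒n>0 i≢0) (FinP.toℕ<n i) g Aig≡g)

  -- A multiplier m of period k for v acts on G through its residue M:
  -- M^k acts as the identity (it is ≡ 1 mod v) and M^i, 0 < i < k, fixes
  -- only ε (M^i - 1 is prime to v), so the powers of M form a Ferrero pair.
  ferrero-from-multiplier : 2 ≤ v → ∀ {k m} → 2 ≤ k → Multiplier k v m → HasFerreroDDF G k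
  ferrero-from-multiplier 2≤v {k} {m} 2≤k mult =
    PowersOfMultiplier.A k M acts-periodically fixes-only-ε ,
    PowersOfMultiplier.ferrero-pair k M acts-periodically fixes-only-ε 2≤k (proj₂ (another-element 2≤v ε))
    where
    instance
      v≢0 : NonZero v
      v≢0 = ℕ.>-nonZero (ℕP.<-trans (s≤s z≤n) 2≤v)
      k≢0 : NonZero k
      k≢0 = ℕ.>-nonZero (ℕP.<-trans (s≤s z≤n) 2≤k)
    M : ℕ
    M = toℕ (Residue.residue v m)
    M^i≡m^i : ∀ i → + (M ℕ.^ i) ≡ m ^ i mod v
    M^i≡m^i i = mod-trans (mod-reflexive (pos-^ M i)) (mod-^ i (Residue.residue-≡ v m))
    acts-periodically : ∀ x → (M ℕ.^ k) · x ≡ x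
    acts-periodically = multiple-≡1 2≤v (M ℕ.^ k) (mod-trans (M^i≡m^i k) (period mult))
    fixes-only-ε : ∀ i → 0 < i → i < k → ∀ x → (M ℕ.^ i) · x ≡ x → x ≡ ε
    fixes-only-ε i 0<i i<k = multiple-fixed-point (M ℕ.^ i) λ q q-prime q∣v M^i≡1 →
      fixedPointFree mult q q-prime q∣v i 0<i i<k (mod-trans (mod-sym (mod-weaken q∣v (M^i≡m^i i))) M^i≡1)

corollary2 : (v k : ℕ) → 2 ≤ v → 2 ≤ k → AllPrimeFactors≡1Mod v k →
    (G : FinAbelianGroup v) → HasFerreroDDF G k
corollary2 v k 2≤v 2≤k ≡1 G =
  ferrero-from-multiplier G 2≤v 2≤k (proj₂ (multiplier-exists v k {{ℕ.>-nonZero (ℕP.<-trans (s≤s z≤n) 2≤v)}} ≡1))
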